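{- Let $P$ be a tableau such that $P^t$ is semistandard and $\mathsf{row}(P)$ is fully-commutative, and let $x$ be an integer such that $\mathsf{row}(P)\cdot x$ is fully-commutative. Then $\mathsf{row}(P\leftarrow x)\equiv_{\mathcal{H}_0}\mathsf{row}(P)\cdot x$.
   Context: The 0-Hecke monoid: words in positive integers modulo the equivalence $\equiv_{\mathcal{H}_0}$ generated by $pq=qp$ ($|p-q|>1$), $pqp=qpq$, $pp=p$ on consecutive subwords; a word is fully-commutative if no minimal-length word equivalent to it contains a consecutive subword $i(i+1)i$ or $i(i-1)i$. Tableaux are in French notation (rows numbered from the bottom) with positive integer entries. $P^t$ semistandard means the rows of $P$ strictly increase left to right and the columns weakly increase bottom to top. $\mathsf{row}(P)$ is the row reading word: the rows read from the top row down to the bottom row, each from left to right. $P\leftarrow x$ ($\star$-insertion): insert $x$ into the bottom row; inserting a letter $x$ into a row $R$: Case 1: if $R$ is empty or $x>\max(R)$, append $x$ to $R$ and stop. Case 2: otherwise if $x\notin R$, let $y$ be the smallest entry of $R$ with $y>x$, replace $y$ by $x$ and insert $y$ into the next row up. Case 3: if $x\in R$, let $y$ be the smallest entry of $R$ with $[y,x]\subseteq R$; leave $R$ unchanged and insert $y$ into the next row up. -}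

module Defs where

open import Data.Nat using (ℕ; zero; suc; _≤_; _<_; _≟_; _<?_; ∣_-_∣)
open import Data.List using (List; []; _∷_; _++_; length; concat; reverse; [_])
open import Data.List.Relation.Unary.All using (All)
open import Data.List.Relation.Unary.Linked using (Linked)
open import Data.List.Membership.DecPropositional _≟_ using (_∈?_)
open import Data.Maybe using (Maybe; just; nothing)
open import Data.Product using (_×_; _,_; ∃-syntax)
open import Data.Sum using (_⊎_)
open import Data.Unit using (⊤)
open import Data.Empty using (⊥)
open import Relation.Nullary using (¬_; yes; no)
open import Relation.Binary.PropositionalEquality using (_≡_; _≢_)
open import Relation.Binary.Construct.Closure.Equivalence using (EqClosure)

-- Words in positive integers are lists of naturals (positivity imposed as hypotheses).
Word : Set
Word = List ℕ

data Rule : Word → Word → Set where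
  comm  : ∀ p q → 1 < ∣ p - q ∣ → Rule (p ∷ q ∷ []) (q ∷ p ∷ [])
  braid : ∀ p q → Rule (p ∷ q ∷ p ∷ []) (q ∷ p ∷ q ∷ [])
  idem  : ∀ p → Rule (p ∷ p ∷ []) (p ∷ [])

data Step : Word → Word → Set where
  step : ∀ a l r b → Rule l r → Step (a ++ l ++ b) (a ++ r ++ b)

_≡H_ : Word → Word → Set
_≡H_ = EqClosure Step

HasBraid : Word → Set
HasBraid v = ∃[ a ] ∃[ b ] ∃[ i ]
  ((v ≡ a ++ (i ∷ suc i ∷ i ∷ []) ++ b) ⊎ (v ≡ a ++ (suc i ∷ i ∷ suc i ∷ []) ++ b))

MinimalEquiv : Word → Word → Set
MinimalEquiv v w = (v ≡H w) × (∀ u → u ≡H w → length v ≤ length u)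

FullyCommutative : Word → Set
FullyCommutative w = ∀ v → MinimalEquiv v w → ¬ HasBraid v

-- Tableaux (French notation): list of rows, bottom row first.

Tableau : Set
Tableau = List (List ℕ)

-- lower row R, upper row S: S is no longer than R, and columns weakly increase upward
ColumnsWeak : List ℕ → List ℕ → Set
ColumnsWeak R       []      = ⊤
ColumnsWeak []      (s ∷ S) = ⊥
ColumnsWeak (r ∷ R) (s ∷ S) = (r ≤ s) × ColumnsWeak R S

-- P is a tableau (partition shape, nonempty rows, positive entries) with P^t semistandard:
-- rows strictly increase left to right, columns weakly increase bottom to top.
TransposeSemistandard : Tableau → Set
TransposeSemistandard P =
  All (λ R → R ≢ []) P × All (All (1 ≤_)) P × All (Linked _<_) P × Linked ColumnsWeak P

row : Tableau → Word
row P = concat (reverse P)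

smallestAbove : ℕ → List ℕ → Maybe ℕ
smallestAbove x [] = nothing
smallestAbove x (r ∷ R) with smallestAbove x R | x <? r
... | m        | no _  = m
... | nothing  | yes _ = just r
... | just y   | yes _ with r <? y
...   | yes _ = just r
...   | no _  = just y

replace : ℕ → ℕ → List ℕ → List ℕ
replace y x [] = []
replace y x (r ∷ R) with r ≟ y
... | yes _ = x ∷ replace y x R
... | no _  = r ∷ replace y x R

-- for x ∈ R: smallest y with [y,x] ⊆ R
downFrom : ℕ → List ℕ → ℕ
downFrom zero    R = zero
downFrom (suc n) R with n ∈? R
... | yes _ = downFrom n R
... | no _  = suc n

rowInsert : ℕ → List ℕ → List ℕ × Maybe ℕ
rowInsert x R with x ∈? R
... | yes _ = R , just (downFrom x R)
... | no _ with smallestAbove x R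
...   | nothing = R ++ [ x ] , nothing
...   | just y  = replace y x R , just y

_←_ : Tableau → ℕ → Tableau
[]      ← x = [ [ x ] ]
(R ∷ P) ← x with rowInsert x R
... | R′ , nothing = R′ ∷ P
... | R′ , just y  = R′ ∷ (P ← y)

-- The 0-Hecke monoid acts on sequences ℕ → ℕ, the letter i by a bubble-sort step at positions
-- i, i + 1. Applied to the identity this gives the Demazure product of a word: an ≡H-invariant
-- whose inversion number bounds the length of every equivalent word from below. By the exchange
-- property every word has an equivalent word of exactly that length, and a 321-pattern in the
-- Demazure product can be squeezed onto three consecutive positions a, a + 1, a + 2, producing a
-- minimal word ending in a(a+1)a; so the Demazure product of a fully-commutative word avoids 321.
-- Row insertion is then checked row by row. In Cases 1 and 2, and in Case 3 when x + 1 is not in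
-- the row R, commutations and pp = p turn R·x into y·R′ with y the bumped letter and R′ the new
-- row. In Case 3 with x + 1 ∈ R, R·x is x(x+1)x up to commutations, which creates a 321-pattern
-- and so cannot happen when row(P)·x is fully commutative.

module Submission where

open import Defs
open import Data.Nat using (ℕ; zero; suc; s≤s⁻¹; _+_; _≤_; _<_; _≟_; _<?_; z≤n; s≤s; ∣_-_∣; _⊔_; _⊓_)
open import Data.Nat.Properties
open import Data.Nat.Tactic.RingSolver using (solve-∀)
open import Data.Nat.ListAction using (sum)
open import Data.List using (List; []; _∷_; _++_; [_]; length; concat; reverse; initLast; _∷ʳ′_)
open import Data.List.Properties using (++-assoc; ++-identityʳ; length-++; unfold-reverse; concat-++)
open import Data.List.Relation.Unary.All using (All; []; _∷_) renaming (map to all-map; lookup to all-lookup)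
open import Data.List.Relation.Unary.All.Properties using (++⁺; ++⁻ˡ; ++⁻ʳ)
open import Data.List.Relation.Unary.Any using (here; there)
open import Data.List.Relation.Unary.Linked using (Linked; []; [-]; _∷_)
import Data.List.Relation.Unary.Linked as Linked
open import Data.List.Relation.Unary.Linked.Properties using (Linked⇒All)
open import Data.List.Membership.DecPropositional _≟_ using (_∈?_; _∈_; _∉_)
open import Data.Maybe using (Maybe; just; nothing)
open import Data.Product using (Σ; _×_; _,_; proj₁; proj₂)
open import Data.Sum using (_⊎_; inj₁; inj₂)
import Data.Sum as Sum
open import Data.Empty using (⊥; ⊥-elim)
open import Function using (_∘_)
open import Function.Definitions using (Injective)
open import Relation.Nullary using (Dec; yes; no; ¬_)
open import Relation.Binary.Definitions using (Tri; tri<; tri≈; tri>)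
open import Relation.Binary.PropositionalEquality hiding ([_])
open import Relation.Binary.Construct.Closure.ReflexiveTransitive using (ε; _◅_)
open import Relation.Binary.Construct.Closure.Symmetric using (fwd; bwd)
import Relation.Binary.Construct.Closure.Equivalence as EC

≡H-refl : ∀ {w} → w ≡H w
≡H-refl = ε

≡H-sym : ∀ {u v} → u ≡H v → v ≡H u
≡H-sym = EC.symmetric Step

infixr 5 _⟫_
_⟫_ : ∀ {u v w} → u ≡H v → v ≡H w → u ≡H w
_⟫_ = EC.transitive Step

≡H-reflexive : ∀ {u v} → u ≡ v → u ≡H v
≡H-reflexive refl = ε

step-cong : ∀ c d {u v} → Step u v → Step (c ++ u ++ d) (c ++ v ++ d)
step-cong c d (step a l r b x) = subst₂ Step (regroup l) (regroup r) (step (c ++ a) l r (b ++ d) x)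
  where
  regroup : ∀ m → (c ++ a) ++ m ++ b ++ d ≡ c ++ (a ++ m ++ b) ++ d
  regroup m = trans (++-assoc c a _)
    (cong (c ++_) (sym (trans (++-assoc a (m ++ b) d) (cong (a ++_) (++-assoc m b d)))))

≡H-cong : ∀ c d {u v} → u ≡H v → (c ++ u ++ d) ≡H (c ++ v ++ d)
≡H-cong c d = EC.gmap (λ u → c ++ u ++ d) (step-cong c d)

≡H-congˡ : ∀ c {u v} → u ≡H v → (c ++ u) ≡H (c ++ v)
≡H-congˡ c {u} {v} e =
  subst₂ _≡H_ (cong (c ++_) (++-identityʳ u)) (cong (c ++_) (++-identityʳ v)) (≡H-cong c [] e)

≡H-congʳ : ∀ d {u v} → u ≡H v → (u ++ d) ≡H (v ++ d)
≡H-congʳ d = ≡H-cong [] d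

≡H-∷ : ∀ a {u v} → u ≡H v → (a ∷ u) ≡H (a ∷ v)
≡H-∷ a = ≡H-congˡ [ a ]

≡H-rule : ∀ {l r} → Rule l r → l ≡H r
≡H-rule {l} {r} x = EC.return (subst₂ Step (++-identityʳ l) (++-identityʳ r) (step [] l r [] x))

≡H-rule-++ : ∀ {l r} d → Rule l r → (l ++ d) ≡H (r ++ d)
≡H-rule-++ d x = ≡H-congʳ d (≡H-rule x)

≡H-snoc-++ : ∀ {u v} a l → u ≡H (v ++ [ a ]) → (u ++ l) ≡H (v ++ a ∷ l)
≡H-snoc-++ {u} {v} a l e = ≡H-congʳ l e ⟫ ≡H-reflexive (++-assoc v [ a ] l)

-- A record rather than a synonym, so that p and q can be inferred from a proof.
record Distant (p q : ℕ) : Set where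
  constructor distant
  field apart : 1 < ∣ p - q ∣
open Distant public

commute : ∀ p q d → Distant p q → (p ∷ q ∷ d) ≡H (q ∷ p ∷ d)
commute p q d h = ≡H-rule-++ d (comm p q (apart h))

distant-sym : ∀ {p q} → Distant p q → Distant q p
distant-sym {p} {q} (distant h) = distant (subst (1 <_) (∣-∣-comm p q) h)

∣1+n-n∣≡1 : ∀ n → ∣ suc n - n ∣ ≡ 1
∣1+n-n∣≡1 zero = refl
∣1+n-n∣≡1 (suc n) = ∣1+n-n∣≡1 n

distant⇒≢ : ∀ {p q} → Distant p q → p ≢ q
distant⇒≢ {p} (distant h) refl = <-irrefl (sym (∣n-n∣≡0 p)) (≤-trans (s≤s z≤n) h)

distant⇒≢1+ : ∀ {p q} → Distant p q → p ≢ suc q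
distant⇒≢1+ {q = q} (distant h) refl = <-irrefl (sym (∣1+n-n∣≡1 q)) h

distant⇒1+≢ : ∀ {p q} → Distant p q → suc p ≢ q
distant⇒1+≢ h e = distant⇒≢1+ (distant-sym h) (sym e)

distant⇒1+≢1+ : ∀ {p q} → Distant p q → suc p ≢ suc q
distant⇒1+≢1+ h e = distant⇒≢ h (suc-injective e)

<⇒distant : ∀ {p q} → suc p < q → Distant p q
<⇒distant {zero} {suc (suc q)} (s≤s (s≤s z≤n)) = distant (s≤s (s≤s z≤n))
<⇒distant {suc p} {suc q} (s≤s h) = distant (apart (<⇒distant {p} {q} h))

≢⇒distant : ∀ p q → p ≢ q → q ≢ suc p → p ≢ suc q → Distant p q
≢⇒distant zero zero a b c = ⊥-elim (a refl)
≢⇒distant zero (suc zero) a b c = ⊥-elim (b refl)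
≢⇒distant zero (suc (suc q)) a b c = distant (s≤s (s≤s z≤n))
≢⇒distant (suc zero) zero a b c = ⊥-elim (c refl)
≢⇒distant (suc (suc p)) zero a b c = distant (s≤s (s≤s z≤n))
≢⇒distant (suc p) (suc q) a b c =
  distant (apart (≢⇒distant p q (a ∘ cong suc) (b ∘ cong suc) (c ∘ cong suc)))

commute-past : ∀ x B → All (Distant x) B → (B ++ [ x ]) ≡H (x ∷ B)
commute-past x [] [] = ≡H-refl
commute-past x (b ∷ B) (h ∷ hs) = ≡H-∷ b (commute-past x B hs) ⟫ commute b x B (distant-sym h)

-- The 0-Hecke monoid acting on sequences by sorting steps

τ : ℕ → ℕ → ℕ
τ i n with n ≟ i
... | yes _ = suc i
... | no _ with n ≟ suc i
...   | yes _ = i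
...   | no _ = n

τ-i : ∀ i → τ i i ≡ suc i
τ-i i with i ≟ i
... | yes _ = refl
... | no i≢i = ⊥-elim (i≢i refl)

τ-1+i : ∀ i → τ i (suc i) ≡ i
τ-1+i i with suc i ≟ i
... | yes e = ⊥-elim (1+n≢n e)
... | no _ with suc i ≟ suc i
...   | yes _ = refl
...   | no ne = ⊥-elim (ne refl)

τ-other : ∀ {i n} → n ≢ i → n ≢ suc i → τ i n ≡ n
τ-other {i} {n} a b with n ≟ i
... | yes e = ⊥-elim (a e)
... | no _ with n ≟ suc i
...   | yes e = ⊥-elim (b e)
...   | no _ = refl

τ-involutive : ∀ i n → τ i (τ i n) ≡ n
τ-involutive i n with n ≟ i
... | yes refl = τ-1+i i
... | no a with n ≟ suc i
...   | yes refl = τ-i i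
...   | no b = τ-other a b

τ-injective : ∀ i → Injective _≡_ _≡_ (τ i)
τ-injective i {a} {b} e = trans (sym (τ-involutive i a)) (trans (cong (τ i) e) (τ-involutive i b))

τ-below : ∀ {i a} → a < i → τ i a ≡ a
τ-below h = τ-other (<⇒≢ h) (<⇒≢ (m<n⇒m<1+n h))

τ-above : ∀ {i a} → suc (suc i) ≤ a → τ i a ≡ a
τ-above h = τ-other (λ e → <-irrefl (sym e) (≤-trans (n≤1+n _) h)) (λ e → <-irrefl (sym e) h)

τ-fixes-distant : ∀ {p q} → Distant p q → τ q p ≡ p
τ-fixes-distant h = τ-other (distant⇒≢ h) (distant⇒≢1+ h)

τ-fixes-distant-1+ : ∀ {p q} → Distant p q → τ q (suc p) ≡ suc p
τ-fixes-distant-1+ h = τ-other (distant⇒1+≢ h) (distant⇒1+≢1+ h)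

τ-comm : ∀ {p q} → Distant p q → ∀ n → τ p (τ q n) ≡ τ q (τ p n)
τ-comm {p} {q} h n with p ≟ n | suc p ≟ n | q ≟ n | suc q ≟ n
... | yes refl | _ | _ | _ =
  trans (cong (τ p) (τ-fixes-distant h)) (trans (τ-i p) (sym (trans (cong (τ q) (τ-i p)) (τ-fixes-distant-1+ h))))
... | no _ | yes refl | _ | _ =
  trans (cong (τ p) (τ-fixes-distant-1+ h)) (trans (τ-1+i p) (sym (trans (cong (τ q) (τ-1+i p)) (τ-fixes-distant h))))
... | no _ | no _ | yes refl | _ =
  trans (cong (τ p) (τ-i q)) (trans (τ-fixes-distant-1+ h′) (sym (trans (cong (τ q) (τ-fixes-distant h′)) (τ-i q))))
  where
  h′ : Distant q p
  h′ = distant-sym h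
... | no _ | no _ | no _ | yes refl =
  trans (cong (τ p) (τ-1+i q)) (trans (τ-fixes-distant h′) (sym (trans (cong (τ q) (τ-fixes-distant-1+ h′)) (τ-1+i q))))
  where
  h′ : Distant q p
  h′ = distant-sym h
... | no a | no b | no c | no d =
  trans (cong (τ p) (τ-other (≢-sym c) (≢-sym d)))
    (trans (τ-other (≢-sym a) (≢-sym b)) (sym (trans (cong (τ q) (τ-other (≢-sym a) (≢-sym b))) (τ-other (≢-sym c) (≢-sym d)))))

τ-mono : ∀ i {x y} → x < y → (x ≡ i → y ≢ suc i) → τ i x < τ i y
τ-mono i {x} {y} lt ne with i ≟ x
... | yes refl = subst (_< τ i y) (sym (τ-i i))
      (subst (suc i <_) (sym (τ-other (λ e → <-irrefl (sym e) lt) (ne refl))) (≤∧≢⇒< lt (λ e → ne refl (sym e))))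
... | no xi′ with suc i ≟ x
... | yes refl = subst (_< τ i y) (sym (τ-1+i i))
      (subst (i <_) (sym (τ-other (λ e → <-asym lt (subst (_< suc i) (sym e) ≤-refl)) (λ e → <-irrefl (sym e) lt)))
        (<-trans ≤-refl lt))
... | no xsi′ with i ≟ y
... | yes refl = subst (_< τ i i) (sym (τ-other (≢-sym xi′) (≢-sym xsi′))) (subst (x <_) (sym (τ-i i)) (m<n⇒m<1+n lt))
... | no yi′ with suc i ≟ y
... | yes refl = subst (_< τ i (suc i)) (sym (τ-other (≢-sym xi′) (≢-sym xsi′)))
      (subst (x <_) (sym (τ-1+i i)) (≤∧≢⇒< (s≤s⁻¹ lt) (≢-sym xi′)))
... | no ysi′ = subst₂ _<_ (sym (τ-other (≢-sym xi′) (≢-sym xsi′))) (sym (τ-other (≢-sym yi′) (≢-sym ysi′))) lt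

swapAt : ℕ → (ℕ → ℕ) → ℕ → ℕ
swapAt i f n = f (τ i n)

swapAt-i : ∀ i f → swapAt i f i ≡ f (suc i)
swapAt-i i f = cong f (τ-i i)

swapAt-1+i : ∀ i f → swapAt i f (suc i) ≡ f i
swapAt-1+i i f = cong f (τ-1+i i)

swapAt-distant : ∀ {p q} f → Distant p q → swapAt q f p ≡ f p
swapAt-distant f h = cong f (τ-fixes-distant h)

swapAt-distant-1+ : ∀ {p q} f → Distant p q → swapAt q f (suc p) ≡ f (suc p)
swapAt-distant-1+ f h = cong f (τ-fixes-distant-1+ h)

π : ℕ → (ℕ → ℕ) → ℕ → ℕ
π i f with f i <? f (suc i)
... | yes _ = swapAt i f
... | no _ = f

π-ascent : ∀ {i f} → f i < f (suc i) → π i f ≡ swapAt i f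
π-ascent {i} {f} h with f i <? f (suc i)
... | yes _ = refl
... | no n = ⊥-elim (n h)

π-nonascent : ∀ {i f} → ¬ (f i < f (suc i)) → π i f ≡ f
π-nonascent {i} {f} h with f i <? f (suc i)
... | yes y = ⊥-elim (h y)
... | no _ = refl

π-cases : ∀ i f → (f i < f (suc i) × π i f ≡ swapAt i f) ⊎ (¬ (f i < f (suc i)) × π i f ≡ f)
π-cases i f with f i <? f (suc i)
... | yes h = inj₁ (h , refl)
... | no h = inj₂ (h , refl)

π-other : ∀ i f {n} → n ≢ i → n ≢ suc i → π i f n ≡ f n
π-other i f a b with f i <? f (suc i)
... | yes _ = cong f (τ-other a b)
... | no _ = refl

π-i : ∀ i f → π i f i ≡ f i ⊔ f (suc i)
π-i i f with f i <? f (suc i)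
... | yes h = trans (swapAt-i i f) (sym (m≤n⇒m⊔n≡n (<⇒≤ h)))
... | no h = sym (m≥n⇒m⊔n≡m (≮⇒≥ h))

π-1+i : ∀ i f → π i f (suc i) ≡ f i ⊓ f (suc i)
π-1+i i f with f i <? f (suc i)
... | yes h = trans (swapAt-1+i i f) (sym (m≤n⇒m⊓n≡m (<⇒≤ h)))
... | no h = sym (m≥n⇒m⊓n≡n (≮⇒≥ h))

π-cong : ∀ i {f g} → f ≗ g → π i f ≗ π i g
π-cong i {f} {g} e n with f i <? f (suc i) | g i <? g (suc i)
... | yes _ | yes _ = e (τ i n)
... | no _ | no _ = e n
... | yes h | no k = ⊥-elim (k (subst₂ _<_ (e i) (e (suc i)) h))
... | no k | yes h = ⊥-elim (k (subst₂ _<_ (sym (e i)) (sym (e (suc i))) h))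

π-injective : ∀ i {f} → Injective _≡_ _≡_ f → Injective _≡_ _≡_ (π i f)
π-injective i {f} inj with π-cases i f
... | inj₁ (_ , e) rewrite e = λ eq → τ-injective i (inj eq)
... | inj₂ (_ , e) rewrite e = inj

nonascent⇒descent : ∀ {f} i → Injective _≡_ _≡_ f → ¬ (f i < f (suc i)) → f (suc i) < f i
nonascent⇒descent i inj n = ≤∧≢⇒< (≮⇒≥ n) (λ e → 1+n≢n (inj e))

π-descent : ∀ i {f} → Injective _≡_ _≡_ f → π i f (suc i) < π i f i
π-descent i {f} inj with π-cases i f
... | inj₁ (lt , e) rewrite e = subst₂ _<_ (sym (swapAt-1+i i f)) (sym (swapAt-i i f)) lt
... | inj₂ (nlt , e) rewrite e = nonascent⇒descent i inj nlt

act : Word → (ℕ → ℕ) → ℕ → ℕ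
act [] f = f
act (i ∷ w) f = act w (π i f)

-- The Demazure product of w, as a permutation of ℕ in one-line notation.
demazure : Word → ℕ → ℕ
demazure w = act w (λ n → n)

act-cong : ∀ w {f g} → f ≗ g → act w f ≗ act w g
act-cong [] e = e
act-cong (i ∷ w) e = act-cong w (π-cong i e)

act-++ : ∀ u v f → act (u ++ v) f ≡ act v (act u f)
act-++ [] v f = refl
act-++ (i ∷ u) v f = act-++ u v (π i f)

demazure-snoc : ∀ u i → demazure (u ++ [ i ]) ≡ π i (demazure u)
demazure-snoc u i = act-++ u [ i ] _

demazure-snoc₂ : ∀ u a b → demazure (u ++ a ∷ b ∷ []) ≡ π b (π a (demazure u))
demazure-snoc₂ u a b = act-++ u (a ∷ b ∷ []) _

act-injective : ∀ w {f} → Injective _≡_ _≡_ f → Injective _≡_ _≡_ (act w f)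
act-injective [] inj = inj
act-injective (i ∷ w) inj = act-injective w (π-injective i inj)

demazure-injective : ∀ w → Injective _≡_ _≡_ (demazure w)
demazure-injective w = act-injective w (λ e → e)

π-idem : ∀ p f → π p (π p f) ≡ π p f
π-idem p f with π-cases p f
... | inj₁ (h , e) rewrite e = π-nonascent {p} {swapAt p f} (λ k → <-asym h (subst₂ _<_ (swapAt-i p f) (swapAt-1+i p f) k))
... | inj₂ (h , e) rewrite e = π-nonascent {p} {f} h

π-swapAt-distant : ∀ {i j} → Distant i j → ∀ f → π i (swapAt j f) ≗ swapAt j (π i f)
π-swapAt-distant {i} {j} h f m with π-cases i f
... | inj₁ (lt , e) =
  trans (cong-app (π-ascent {i} {swapAt j f} (subst₂ _<_ (sym (swapAt-distant f h)) (sym (swapAt-distant-1+ f h)) lt)) m)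
    (trans (cong f (τ-comm (distant-sym h) m)) (sym (cong-app e (τ j m))))
... | inj₂ (nlt , e) =
  trans (cong-app (π-nonascent {i} {swapAt j f} (λ k → nlt (subst₂ _<_ (swapAt-distant f h) (swapAt-distant-1+ f h) k))) m)
    (sym (cong-app e (τ j m)))

π-fixes-distant : ∀ {p q} → Distant p q → ∀ f → π q f p ≡ f p
π-fixes-distant {q = q} h f = π-other q f (distant⇒≢ h) (distant⇒≢1+ h)

π-fixes-distant-1+ : ∀ {p q} → Distant p q → ∀ f → π q f (suc p) ≡ f (suc p)
π-fixes-distant-1+ {q = q} h f = π-other q f (distant⇒1+≢ h) (distant⇒1+≢1+ h)

π-comm : ∀ {p q} → Distant p q → ∀ f → π q (π p f) ≗ π p (π q f)
π-comm {p} {q} h f n with π-cases p f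
... | inj₁ (asc , e) = begin
  π q (π p f) n         ≡⟨ cong (λ g → π q g n) e ⟩
  π q (swapAt p f) n    ≡⟨ π-swapAt-distant (distant-sym h) f n ⟩
  swapAt p (π q f) n    ≡⟨ cong-app (π-ascent {p} {π q f} ascent) n ⟨
  π p (π q f) n         ∎
  where
  open ≡-Reasoning
  ascent : π q f p < π q f (suc p)
  ascent = subst₂ _<_ (sym (π-fixes-distant h f)) (sym (π-fixes-distant-1+ h f)) asc
... | inj₂ (nasc , e) = trans (cong (λ g → π q g n) e)
  (sym (cong-app (π-nonascent {p} {π q f} (λ k → nasc (subst₂ _<_ (π-fixes-distant h f) (π-fixes-distant-1+ h f) k))) n))

n≢1+n : ∀ {n} → n ≢ suc n
n≢1+n e = 1+n≢n (sym e)

n≢2+n : ∀ {n} → n ≢ suc (suc n)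
n≢2+n ()

2+n≢n : ∀ {n} → suc (suc n) ≢ n
2+n≢n e = n≢2+n (sym e)

sort3-max : ∀ a b c → (a ⊔ b) ⊔ ((a ⊓ b) ⊔ c) ≡ a ⊔ (b ⊔ c)
sort3-max a b c = trans (sym (⊔-assoc (a ⊔ b) (a ⊓ b) c))
  (trans (cong (_⊔ c) (m≥n⇒m⊔n≡m (≤-trans (m⊓n≤m a b) (m≤m⊔n a b)))) (⊔-assoc a b c))

sort3-median : ∀ a b c → (a ⊔ b) ⊓ ((a ⊓ b) ⊔ c) ≡ (a ⊓ (b ⊔ c)) ⊔ (b ⊓ c)
sort3-median a b c = trans (⊓-distribˡ-⊔ (a ⊔ b) (a ⊓ b) c)
  (trans (cong₂ _⊔_ (m≥n⇒m⊓n≡n (≤-trans (m⊓n≤m a b) (m≤m⊔n a b))) (⊓-distribʳ-⊔ c a b))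
  (sym (trans (cong (_⊔ (b ⊓ c)) (⊓-distribˡ-⊔ a b c)) (⊔-assoc (a ⊓ b) (a ⊓ c) (b ⊓ c)))))

sort3-min : ∀ a b c → (a ⊓ b) ⊓ c ≡ (a ⊓ (b ⊔ c)) ⊓ (b ⊓ c)
sort3-min a b c = sym (trans (⊓-assoc a (b ⊔ c) (b ⊓ c))
  (trans (cong (a ⊓_) (m≥n⇒m⊓n≡n (≤-trans (m⊓n≤m b c) (m≤m⊔n b c)))) (sym (⊓-assoc a b c))))

-- Both sides of the braid relation act on the entries a, b, c at p, p + 1, p + 2 as a sorting
-- network; the two networks differ, but they output the same maximum, median and minimum.
module BraidRelation (p : ℕ) (f : ℕ → ℕ) where

  private
    a = f p
    b = f (suc p)
    c = f (suc (suc p))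
    g = π (suc p) (π p f)
    h = π p (π (suc p) f)

  g-p : g p ≡ a ⊔ b
  g-p = trans (π-other (suc p) (π p f) n≢1+n n≢2+n) (π-i p f)

  g-1+p : g (suc p) ≡ (a ⊓ b) ⊔ c
  g-1+p = trans (π-i (suc p) (π p f)) (cong₂ _⊔_ (π-1+i p f) (π-other p f 2+n≢n 1+n≢n))

  g-2+p : g (suc (suc p)) ≡ (a ⊓ b) ⊓ c
  g-2+p = trans (π-1+i (suc p) (π p f)) (cong₂ _⊓_ (π-1+i p f) (π-other p f 2+n≢n 1+n≢n))

  h-p : h p ≡ a ⊔ (b ⊔ c)
  h-p = trans (π-i p (π (suc p) f)) (cong₂ _⊔_ (π-other (suc p) f n≢1+n n≢2+n) (π-i (suc p) f))

  h-1+p : h (suc p) ≡ a ⊓ (b ⊔ c)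
  h-1+p = trans (π-1+i p (π (suc p) f)) (cong₂ _⊓_ (π-other (suc p) f n≢1+n n≢2+n) (π-i (suc p) f))

  h-2+p : h (suc (suc p)) ≡ b ⊓ c
  h-2+p = trans (π-other p (π (suc p) f) 2+n≢n 1+n≢n) (π-1+i (suc p) f)

  π-braid : π p g ≗ π (suc p) h
  π-braid n with n ≟ p
  ... | yes refl = begin
    π p g p                        ≡⟨ π-i p g ⟩
    g p ⊔ g (suc p)                ≡⟨ cong₂ _⊔_ g-p g-1+p ⟩
    (a ⊔ b) ⊔ ((a ⊓ b) ⊔ c)        ≡⟨ sort3-max a b c ⟩
    a ⊔ (b ⊔ c)                    ≡⟨ trans (π-other (suc p) h n≢1+n n≢2+n) h-p ⟨
    π (suc p) h p                  ∎
    where open ≡-Reasoning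
  ... | no n≢p with n ≟ suc p
  ... | yes refl = begin
    π p g (suc p)                  ≡⟨ π-1+i p g ⟩
    g p ⊓ g (suc p)                ≡⟨ cong₂ _⊓_ g-p g-1+p ⟩
    (a ⊔ b) ⊓ ((a ⊓ b) ⊔ c)        ≡⟨ sort3-median a b c ⟩
    (a ⊓ (b ⊔ c)) ⊔ (b ⊓ c)        ≡⟨ trans (π-i (suc p) h) (cong₂ _⊔_ h-1+p h-2+p) ⟨
    π (suc p) h (suc p)            ∎
    where open ≡-Reasoning
  ... | no n≢1+p with n ≟ suc (suc p)
  ... | yes refl = begin
    π p g (suc (suc p))            ≡⟨ trans (π-other p g 2+n≢n 1+n≢n) g-2+p ⟩
    (a ⊓ b) ⊓ c                    ≡⟨ sort3-min a b c ⟩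
    (a ⊓ (b ⊔ c)) ⊓ (b ⊓ c)        ≡⟨ trans (π-1+i (suc p) h) (cong₂ _⊓_ h-1+p h-2+p) ⟨
    π (suc p) h (suc (suc p))      ∎
    where open ≡-Reasoning
  ... | no n≢2+p =
    trans (π-other p g n≢p n≢1+p) (trans (π-other (suc p) (π p f) n≢1+p n≢2+p) (trans (π-other p f n≢p n≢1+p)
      (sym (trans (π-other (suc p) h n≢1+p n≢2+p) (trans (π-other p (π (suc p) f) n≢p n≢1+p) (π-other (suc p) f n≢1+p n≢2+p))))))

open BraidRelation using (π-braid)

act-rule : ∀ {l r} → Rule l r → ∀ f → act l f ≗ act r f
act-rule (comm p q h) f = π-comm (distant h) f
act-rule (idem p) f = cong-app (π-idem p f)
act-rule (braid p q) f n with p ≟ q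
... | yes refl = refl
... | no p≢q with q ≟ suc p
... | yes refl = π-braid p f n
... | no q≢1+p with p ≟ suc q
... | yes refl = sym (π-braid q f n)
... | no p≢1+q =
  trans (π-cong p (π-comm h f) n) (trans (cong-app (π-idem p (π q f)) n)
    (sym (trans (π-cong q (π-comm (distant-sym h) f) n) (trans (cong-app (π-idem q (π p f)) n) (π-comm h f n)))))
  where
  h : Distant p q
  h = ≢⇒distant p q p≢q q≢1+p p≢1+q

act-step : ∀ {u v} → Step u v → ∀ f → act u f ≗ act v f
act-step (step a l r b x) f n = begin
  act (a ++ l ++ b) f n        ≡⟨ cong-app (act-++ a (l ++ b) f) n ⟩
  act (l ++ b) (act a f) n     ≡⟨ cong-app (act-++ l b (act a f)) n ⟩
  act b (act l (act a f)) n    ≡⟨ act-cong b (act-rule x (act a f)) n ⟩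
  act b (act r (act a f)) n    ≡⟨ cong-app (act-++ r b (act a f)) n ⟨
  act (r ++ b) (act a f) n     ≡⟨ cong-app (act-++ a (r ++ b) f) n ⟨
  act (a ++ r ++ b) f n        ∎
  where open ≡-Reasoning

act-≡H : ∀ {u v} → u ≡H v → ∀ f → act u f ≗ act v f
act-≡H ε f n = refl
act-≡H (fwd s ◅ ss) f n = trans (act-step s f n) (act-≡H ss f n)
act-≡H (bwd s ◅ ss) f n = trans (sym (act-step s f n)) (act-≡H ss f n)

-- Inversions bound the length of words from below

indicator : ∀ {P : Set} → Dec P → ℕ
indicator (yes _) = 1
indicator (no _) = 0

indicator-yes : ∀ {P : Set} (d : Dec P) → P → indicator d ≡ 1
indicator-yes (yes _) _ = refl
indicator-yes (no n) p = ⊥-elim (n p)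

indicator-no : ∀ {P : Set} (d : Dec P) → ¬ P → indicator d ≡ 0
indicator-no (yes p) n = ⊥-elim (n p)
indicator-no (no _) _ = refl

countAbove : (ℕ → ℕ) → ℕ → ℕ → ℕ
countAbove f v zero = 0
countAbove f v (suc b) = countAbove f v b + indicator (v <? f b)

inversions : (ℕ → ℕ) → ℕ → ℕ
inversions f zero = 0
inversions f (suc M) = inversions f M + countAbove f (f M) M

+-swap-last : ∀ a x y → a + x + y ≡ a + y + x
+-swap-last = solve-∀

countAbove-cong : ∀ {f g} v b → (∀ a → a < b → f a ≡ g a) → countAbove f v b ≡ countAbove g v b
countAbove-cong v zero e = refl
countAbove-cong v (suc b) e =
  cong₂ _+_ (countAbove-cong v b (λ a h → e a (m<n⇒m<1+n h))) (cong (λ x → indicator (v <? x)) (e b ≤-refl))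

inversions-cong : ∀ {f g} M → (∀ a → a < M → f a ≡ g a) → inversions f M ≡ inversions g M
inversions-cong zero e = refl
inversions-cong {f} {g} (suc M) e = cong₂ _+_ (inversions-cong M (λ a h → e a (m<n⇒m<1+n h)))
  (trans (cong (λ x → countAbove f x M) (e M ≤-refl)) (countAbove-cong (g M) M (λ a h → e a (m<n⇒m<1+n h))))

inversions-≗ : ∀ {f g} M → f ≗ g → inversions f M ≡ inversions g M
inversions-≗ M e = inversions-cong M (λ a _ → e a)

countAbove-swapAt : ∀ i f v b → suc (suc i) ≤ b → countAbove (swapAt i f) v b ≡ countAbove f v b
countAbove-swapAt i f v zero ()
countAbove-swapAt i f v (suc b) h with suc (suc i) ≟ suc b
... | yes refl = trans
  (cong₂ _+_ (cong₂ _+_ (countAbove-cong v i (λ a h → cong f (τ-below h))) (cong (λ x → indicator (v <? x)) (swapAt-i i f)))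
    (cong (λ x → indicator (v <? x)) (swapAt-1+i i f)))
  (+-swap-last (countAbove f v i) _ _)
... | no ne = cong₂ _+_ (countAbove-swapAt i f v b h′) (cong (λ x → indicator (v <? x)) (cong f (τ-above h′)))
  where
  h′ : suc (suc i) ≤ b
  h′ = s≤s⁻¹ (≤∧≢⇒< h ne)

inversions-swapAt : ∀ i f M → suc i < M →
  inversions (swapAt i f) M + indicator (f (suc i) <? f i) ≡ inversions f M + indicator (f i <? f (suc i))
inversions-swapAt i f (suc M) h with suc (suc i) ≟ suc M
... | yes refl = begin
  inversions (swapAt i f) i + countAbove (swapAt i f) (swapAt i f i) i
    + countAbove (swapAt i f) (swapAt i f (suc i)) (suc i) + indicator (f (suc i) <? f i)
    ≡⟨ cong (_+ indicator (f (suc i) <? f i)) (cong₂ _+_ (cong₂ _+_ (inversions-cong i below)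
         (trans (cong (λ x → countAbove (swapAt i f) x i) (swapAt-i i f)) (countAbove-cong _ i below)))
         (trans (cong (λ x → countAbove (swapAt i f) x (suc i)) (swapAt-1+i i f))
           (cong₂ _+_ (countAbove-cong _ i below) (cong (λ x → indicator (f i <? x)) (swapAt-i i f))))) ⟩
  inversions f i + countAbove f (f (suc i)) i + (countAbove f (f i) i + indicator (f i <? f (suc i)))
    + indicator (f (suc i) <? f i)
    ≡⟨ regroup (inversions f i) (countAbove f (f i) i) (countAbove f (f (suc i)) i)
         (indicator (f i <? f (suc i))) (indicator (f (suc i) <? f i)) ⟩
  inversions f i + countAbove f (f i) i + (countAbove f (f (suc i)) i + indicator (f (suc i) <? f i))
    + indicator (f i <? f (suc i)) ∎
  where
  open ≡-Reasoning
  below : ∀ a → a < i → swapAt i f a ≡ f a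
  below a h = cong f (τ-below h)
  regroup : ∀ l c₀ c₁ x y → l + c₁ + (c₀ + x) + y ≡ l + c₀ + (c₁ + y) + x
  regroup = solve-∀
... | no ne = begin
  inversions (swapAt i f) M + countAbove (swapAt i f) (swapAt i f M) M + d₋
    ≡⟨ cong (λ z → inversions (swapAt i f) M + z + d₋) last-column ⟩
  inversions (swapAt i f) M + c + d₋   ≡⟨ +-swap-last _ c d₋ ⟩
  inversions (swapAt i f) M + d₋ + c   ≡⟨ cong (_+ c) (inversions-swapAt i f M h′) ⟩
  inversions f M + d₊ + c              ≡⟨ +-swap-last _ d₊ c ⟩
  inversions f M + c + d₊              ∎
  where
  open ≡-Reasoning
  h′ : suc i < M
  h′ = s≤s⁻¹ (≤∧≢⇒< h ne)
  c = countAbove f (f M) M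
  d₋ = indicator (f (suc i) <? f i)
  d₊ = indicator (f i <? f (suc i))
  last-column : countAbove (swapAt i f) (swapAt i f M) M ≡ c
  last-column = trans (cong (λ x → countAbove (swapAt i f) x M) (cong f (τ-above h′))) (countAbove-swapAt i f (f M) M h′)

inversions-swapAt-descent : ∀ i f M → f (suc i) < f i → suc i < M → suc (inversions (swapAt i f) M) ≡ inversions f M
inversions-swapAt-descent i f M lt h = begin
  suc (inversions (swapAt i f) M)                            ≡⟨ +-comm 1 _ ⟩
  inversions (swapAt i f) M + 1                              ≡⟨ cong (inversions (swapAt i f) M +_) (indicator-yes (f (suc i) <? f i) lt) ⟨
  inversions (swapAt i f) M + indicator (f (suc i) <? f i)   ≡⟨ inversions-swapAt i f M h ⟩
  inversions f M + indicator (f i <? f (suc i))              ≡⟨ cong (inversions f M +_) (indicator-no (f i <? f (suc i)) (<-asym lt)) ⟩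
  inversions f M + 0                                         ≡⟨ +-identityʳ _ ⟩
  inversions f M                                             ∎
  where open ≡-Reasoning

inversions-π : ∀ i f M → suc i < M → inversions (π i f) M ≤ suc (inversions f M)
inversions-π i f M h with π-cases i f
... | inj₁ (lt , e) rewrite e = ≤-reflexive (begin
  inversions (swapAt i f) M                     ≡⟨ inversions-swapAt-descent i (swapAt i f) M descent h ⟨
  suc (inversions (swapAt i (swapAt i f)) M)    ≡⟨ cong suc (inversions-≗ M (λ n → cong f (τ-involutive i n))) ⟩
  suc (inversions f M)                          ∎)
  where
  open ≡-Reasoning
  descent : swapAt i f (suc i) < swapAt i f i
  descent = subst₂ _<_ (sym (swapAt-1+i i f)) (sym (swapAt-i i f)) lt
... | inj₂ (_ , e) rewrite e = n≤1+n _

countAbove-id : ∀ v b → b ≤ v → countAbove (λ n → n) v b ≡ 0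
countAbove-id v zero h = refl
countAbove-id v (suc b) h =
  cong₂ _+_ (countAbove-id v b (≤-trans (n≤1+n b) h)) (indicator-no (v <? b) (λ k → <-asym k h))

inversions-id : ∀ M → inversions (λ n → n) M ≡ 0
inversions-id zero = refl
inversions-id (suc M) = cong₂ _+_ (inversions-id M) (countAbove-id M M ≤-refl)

inversions-act : ∀ M u f → All (λ i → suc i < M) u → inversions (act u f) M ≤ inversions f M + length u
inversions-act M [] f [] = ≤-reflexive (sym (+-identityʳ _))
inversions-act M (i ∷ u) f (h ∷ hs) = ≤-trans (inversions-act M u (π i f) hs)
  (≤-trans (+-monoˡ-≤ (length u) (inversions-π i f M h)) (≤-reflexive (sym (+-suc _ _))))

inversions-mono : ∀ f M d → inversions f M ≤ inversions f (d + M)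
inversions-mono f M zero = ≤-refl
inversions-mono f M (suc d) = ≤-trans (inversions-mono f M d) (m≤m+n _ _)

≤-sum : ∀ u → All (_≤ sum u) u
≤-sum [] = []
≤-sum (i ∷ u) = m≤m+n i (sum u) ∷ all-map (λ h → ≤-trans h (m≤n+m (sum u) i)) (≤-sum u)

inversions-demazure≤length : ∀ M u → inversions (demazure u) M ≤ length u
inversions-demazure≤length M u = begin
  inversions (demazure u) M                    ≤⟨ inversions-mono (demazure u) M (suc (suc (sum u))) ⟩
  inversions (demazure u) N                    ≤⟨ inversions-act N u (λ n → n) (all-map inside (≤-sum u)) ⟩
  inversions (λ n → n) N + length u            ≡⟨ cong (_+ length u) (inversions-id N) ⟩
  length u                                     ∎
  where
  open ≤-Reasoning
  N = suc (suc (sum u)) + M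
  inside : ∀ {i} → i ≤ sum u → suc i < N
  inside h = ≤-trans (s≤s (s≤s h)) (m≤m+n _ M)

-- The exchange property

record Window (p : ℕ → ℕ) (b : ℕ) (g : ℕ → ℕ) (x y z : ℕ) : Set where
  constructor window
  field
    at₀ : g b ≡ x
    at₁ : g (suc b) ≡ y
    at₂ : g (suc (suc b)) ≡ z
    elsewhere : ∀ n → n ≢ b → n ≢ suc b → n ≢ suc (suc b) → g n ≡ p n

module _ {p : ℕ → ℕ} {b : ℕ} where

  window-init : Window p b p (p b) (p (suc b)) (p (suc (suc b)))
  window-init = window refl refl refl (λ _ _ _ _ → refl)

  window-≗ : ∀ {g h x y z} → g ≗ h → Window p b g x y z → Window p b h x y z
  window-≗ e (window a₀ a₁ a₂ o) =
    window (trans (sym (e _)) a₀) (trans (sym (e _)) a₁) (trans (sym (e _)) a₂)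
      (λ n h₀ h₁ h₂ → trans (sym (e n)) (o n h₀ h₁ h₂))

  window-unique : ∀ {g h x y z} → Window p b g x y z → Window p b h x y z → g ≗ h
  window-unique (window a₀ a₁ a₂ o) (window a₀′ a₁′ a₂′ o′) n with b ≟ n
  ... | yes refl = trans a₀ (sym a₀′)
  ... | no n₀ with suc b ≟ n
  ... | yes refl = trans a₁ (sym a₁′)
  ... | no n₁ with suc (suc b) ≟ n
  ... | yes refl = trans a₂ (sym a₂′)
  ... | no n₂ = trans (o n (≢-sym n₀) (≢-sym n₁) (≢-sym n₂)) (sym (o′ n (≢-sym n₀) (≢-sym n₁) (≢-sym n₂)))

  window-swap₀ : ∀ {g x y z} → Window p b g x y z → Window p b (swapAt b g) y x z
  window-swap₀ {g} (window a₀ a₁ a₂ o) = window (trans (swapAt-i b g) a₁) (trans (swapAt-1+i b g) a₀)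
    (trans (cong g (τ-other 2+n≢n 1+n≢n)) a₂) (λ n h₀ h₁ h₂ → trans (cong g (τ-other h₀ h₁)) (o n h₀ h₁ h₂))

  window-swap₁ : ∀ {g x y z} → Window p b g x y z → Window p b (swapAt (suc b) g) x z y
  window-swap₁ {g} (window a₀ a₁ a₂ o) = window (trans (cong g (τ-other n≢1+n n≢2+n)) a₀)
    (trans (swapAt-i (suc b) g) a₂) (trans (swapAt-1+i (suc b) g) a₁)
    (λ n h₀ h₁ h₂ → trans (cong g (τ-other h₁ h₂)) (o n h₀ h₁ h₂))

  window-π₀ : ∀ {g x y z} → Window p b g x y z → x < y → Window p b (π b g) y x z
  window-π₀ {g} s lt =
    window-≗ (cong-app (sym (π-ascent {b} {g} (subst₂ _<_ (sym (Window.at₀ s)) (sym (Window.at₁ s)) lt)))) (window-swap₀ s)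

  window-π₁ : ∀ {g x y z} → Window p b g x y z → y < z → Window p b (π (suc b) g) x z y
  window-π₁ {g} s lt =
    window-≗ (cong-app (sym (π-ascent {suc b} {g} (subst₂ _<_ (sym (Window.at₁ s)) (sym (Window.at₂ s)) lt)))) (window-swap₁ s)

  module _ {g x y z} (s : Window p b g x y z) where
    open Window s

    window-desc₀ : y < x → g (suc b) < g b
    window-desc₀ = subst₂ _<_ (sym at₁) (sym at₀)

    window-desc₀⁻¹ : g (suc b) < g b → y < x
    window-desc₀⁻¹ = subst₂ _<_ at₁ at₀

    window-desc₁ : z < y → g (suc (suc b)) < g (suc b)
    window-desc₁ = subst₂ _<_ (sym at₂) (sym at₁)

    window-desc₁⁻¹ : g (suc (suc b)) < g (suc b) → z < y
    window-desc₁⁻¹ = subst₂ _<_ at₂ at₁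

-- f and L stand for demazure w and length w; they are kept abstract because demazure (u ++ [ i ])
-- is only propositionally equal to π i (demazure u).
record Exchange (B : ℕ) (w : Word) (j : ℕ) (f : ℕ → ℕ) (L : ℕ) : Set where
  constructor exchanged
  field
    prefix : Word
    prefix-≡H : w ≡H (prefix ++ [ j ])
    prefix-demazure : demazure prefix ≗ swapAt j f
    prefix-shorter : length prefix < L
    prefix-bounded : All (_< B) prefix
open Exchange

ExchangeOf : ℕ → Word → ℕ → Set
ExchangeOf B w j = Exchange B w j (demazure w) (length w)

ExchangeBelow : ℕ → ℕ → Set
ExchangeBelow n B = ∀ u j → length u < n → All (_< B) u → j < B → demazure u (suc j) < demazure u j → ExchangeOf B u j

module _ {B w j f L} (ex : Exchange B w j f L) where

  window-exchange₀ : ∀ {p x y z} → Window p j f x y z → Window p j (demazure (prefix ex)) y x z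
  window-exchange₀ s = window-≗ (λ m → sym (prefix-demazure ex m)) (window-swap₀ s)

  window-exchange₁ : ∀ {p b x y z} → j ≡ suc b → Window p b f x y z → Window p b (demazure (prefix ex)) x z y
  window-exchange₁ refl s = window-≗ (λ m → sym (prefix-demazure ex m)) (window-swap₁ s)

length-snoc : ∀ (u : Word) i → length (u ++ [ i ]) ≡ suc (length u)
length-snoc u i = trans (length-++ u) (+-comm (length u) 1)

length-snoc₂ : ∀ (u : Word) a b → length (u ++ a ∷ b ∷ []) ≡ suc (suc (length u))
length-snoc₂ u a b = trans (length-++ u) (+-comm (length u) 2)

exchange-same : ∀ {n B u i} → ExchangeBelow n B → length u < n → All (_< B) u → i < B
  → π i (demazure u) (suc i) < π i (demazure u) i → Exchange B (u ++ [ i ]) i (π i (demazure u)) (suc (length u))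
exchange-same {u = u} {i} IH lu bu ib d with π-cases i (demazure u)
... | inj₁ (_ , e) =
  exchanged u ≡H-refl (λ m → trans (sym (cong (demazure u) (τ-involutive i m))) (sym (cong-app e (τ i m)))) ≤-refl bu
... | inj₂ (_ , e) with IH u i lu bu ib (subst (λ g → g (suc i) < g i) e d)
... | exchanged u₁ e₁ g₁ l₁ b₁ =
  exchanged u₁ (≡H-snoc-++ i [ i ] e₁ ⟫ ≡H-congˡ u₁ (≡H-rule (idem i))) (λ m → trans (g₁ m) (sym (cong-app e (τ i m))))
    (m<n⇒m<1+n l₁) b₁

exchange-distant : ∀ {n B u i j} → Distant i j → ExchangeBelow n B → length u < n → All (_< B) u → i < B → j < B
  → π i (demazure u) (suc j) < π i (demazure u) j → Exchange B (u ++ [ i ]) j (π i (demazure u)) (suc (length u))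
exchange-distant {u = u} {i} {j} h IH lu bu ib jb d
  with IH u j lu bu jb
         (subst₂ _<_ (untouched (distant⇒1+≢ h′) (distant⇒1+≢1+ h′)) (untouched (distant⇒≢ h′) (distant⇒≢1+ h′)) d)
  where
  h′ : Distant j i
  h′ = distant-sym h
  untouched : ∀ {n} → n ≢ i → n ≢ suc i → π i (demazure u) n ≡ demazure u n
  untouched = π-other i (demazure u)
... | exchanged u₁ e₁ g₁ l₁ b₁ =
  exchanged (u₁ ++ [ i ])
    (≡H-snoc-++ j [ i ] e₁ ⟫ ≡H-congˡ u₁ (commute j i [] (distant-sym h)) ⟫ ≡H-reflexive (sym (++-assoc u₁ [ i ] [ j ])))
    (λ m → trans (cong-app (demazure-snoc u₁ i) m) (trans (π-cong i g₁ m) (π-swapAt-distant h (demazure u) m)))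
    (subst (_< suc (length u)) (sym (length-snoc u₁ i)) (s≤s l₁)) (++⁺ b₁ (ib ∷ []))

module _ {n B u} (IH : ExchangeBelow n B) (lu : length u < n) (bu : All (_< B) u) where

  private
    p = demazure u

  exchange-up-ascent : ∀ {i} → i < B → suc i < B → p i < p (suc i) → p (suc (suc i)) < p i
    → Exchange B (u ++ [ i ]) (suc i) (swapAt i p) (suc (length u))
  exchange-up-ascent {i} ib sib lt d = exchanged (u₂ ++ suc i ∷ i ∷ [])
    (≡H-snoc-++ (suc i) [ i ] (prefix-≡H ex₁) ⟫ ≡H-snoc-++ i (suc i ∷ i ∷ []) (prefix-≡H ex₂)
      ⟫ ≡H-congˡ u₂ (≡H-rule (braid i (suc i))) ⟫ ≡H-reflexive (sym (++-assoc u₂ (suc i ∷ i ∷ []) [ suc i ])))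
    (λ m → trans (cong-app (demazure-snoc₂ u₂ (suc i) i) m)
      (window-unique (window-π₀ (window-π₁ S₂ lt) (<-trans d lt)) (window-swap₁ (window-swap₀ window-init)) m))
    (subst (_< suc (length u)) (sym (length-snoc₂ u₂ (suc i) i))
      (s≤s (≤-trans (s≤s (prefix-shorter ex₂)) (prefix-shorter ex₁))))
    (++⁺ (prefix-bounded ex₂) (sib ∷ ib ∷ []))
    where
    ex₁ : ExchangeOf B u (suc i)
    ex₁ = IH u (suc i) lu bu sib (<-trans d lt)
    S₁ : Window p i (demazure (prefix ex₁)) (p i) (p (suc (suc i))) (p (suc i))
    S₁ = window-exchange₁ ex₁ refl window-init
    ex₂ : ExchangeOf B (prefix ex₁) i
    ex₂ = IH (prefix ex₁) i (<-trans (prefix-shorter ex₁) lu) (prefix-bounded ex₁) ib (window-desc₀ S₁ d)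
    u₂ = prefix ex₂
    S₂ : Window p i (demazure u₂) (p (suc (suc i))) (p i) (p (suc i))
    S₂ = window-exchange₀ ex₂ S₁

  exchange-up-descent : ∀ {i} → i < B → suc i < B → p (suc i) < p i → p (suc (suc i)) < p (suc i)
    → Exchange B (u ++ [ i ]) (suc i) p (suc (length u))
  exchange-up-descent {i} ib sib str d = exchanged (u₃ ++ suc i ∷ i ∷ [])
    (≡H-snoc-++ (suc i) [ i ] (prefix-≡H ex₁) ⟫ ≡H-snoc-++ i (suc i ∷ i ∷ []) (prefix-≡H ex₂)
      ⟫ ≡H-snoc-++ (suc i) (i ∷ suc i ∷ i ∷ []) (prefix-≡H ex₃)
      ⟫ ≡H-congˡ u₃ (≡H-∷ (suc i) (≡H-rule (braid i (suc i)))) ⟫ ≡H-congˡ u₃ (≡H-rule-++ (i ∷ suc i ∷ []) (idem (suc i)))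
      ⟫ ≡H-reflexive (sym (++-assoc u₃ (suc i ∷ i ∷ []) [ suc i ])))
    (λ m → trans (cong-app (demazure-snoc₂ u₃ (suc i) i) m)
      (window-unique (window-π₀ (window-π₁ S₃ str) (<-trans d str)) (window-swap₁ window-init) m))
    (subst (_< suc (length u)) (sym (length-snoc₂ u₃ (suc i) i))
      (s≤s (≤-trans (s≤s (<-trans (prefix-shorter ex₃) (prefix-shorter ex₂))) (prefix-shorter ex₁))))
    (++⁺ (prefix-bounded ex₃) (sib ∷ ib ∷ []))
    where
    ex₁ : ExchangeOf B u (suc i)
    ex₁ = IH u (suc i) lu bu sib d
    S₁ : Window p i (demazure (prefix ex₁)) (p i) (p (suc (suc i))) (p (suc i))
    S₁ = window-exchange₁ ex₁ refl window-init
    ex₂ : ExchangeOf B (prefix ex₁) i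
    ex₂ = IH (prefix ex₁) i (<-trans (prefix-shorter ex₁) lu) (prefix-bounded ex₁) ib (window-desc₀ S₁ (<-trans d str))
    S₂ : Window p i (demazure (prefix ex₂)) (p (suc (suc i))) (p i) (p (suc i))
    S₂ = window-exchange₀ ex₂ S₁
    ex₃ : ExchangeOf B (prefix ex₂) (suc i)
    ex₃ = IH (prefix ex₂) (suc i) (<-trans (prefix-shorter ex₂) (<-trans (prefix-shorter ex₁) lu)) (prefix-bounded ex₂) sib
      (window-desc₁ S₂ str)
    u₃ = prefix ex₃
    S₃ : Window p i (demazure u₃) (p (suc (suc i))) (p (suc i)) (p i)
    S₃ = window-exchange₁ ex₃ refl S₂

  exchange-down-ascent : ∀ {j} → j < B → suc j < B → p (suc j) < p (suc (suc j)) → p (suc (suc j)) < p j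
    → Exchange B (u ++ [ suc j ]) j (swapAt (suc j) p) (suc (length u))
  exchange-down-ascent {j} jb sjb lt d = exchanged (u₂ ++ j ∷ suc j ∷ [])
    (≡H-snoc-++ j [ suc j ] (prefix-≡H ex₁) ⟫ ≡H-snoc-++ (suc j) (j ∷ suc j ∷ []) (prefix-≡H ex₂)
      ⟫ ≡H-congˡ u₂ (≡H-rule (braid (suc j) j)) ⟫ ≡H-reflexive (sym (++-assoc u₂ (j ∷ suc j ∷ []) [ j ])))
    (λ m → trans (cong-app (demazure-snoc₂ u₂ j (suc j)) m)
      (window-unique (window-π₁ (window-π₀ S₂ lt) (<-trans lt d)) (window-swap₀ (window-swap₁ window-init)) m))
    (subst (_< suc (length u)) (sym (length-snoc₂ u₂ j (suc j)))
      (s≤s (≤-trans (s≤s (prefix-shorter ex₂)) (prefix-shorter ex₁))))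
    (++⁺ (prefix-bounded ex₂) (jb ∷ sjb ∷ []))
    where
    ex₁ : ExchangeOf B u j
    ex₁ = IH u j lu bu jb (<-trans lt d)
    S₁ : Window p j (demazure (prefix ex₁)) (p (suc j)) (p j) (p (suc (suc j)))
    S₁ = window-exchange₀ ex₁ window-init
    ex₂ : ExchangeOf B (prefix ex₁) (suc j)
    ex₂ = IH (prefix ex₁) (suc j) (<-trans (prefix-shorter ex₁) lu) (prefix-bounded ex₁) sjb (window-desc₁ S₁ d)
    u₂ = prefix ex₂
    S₂ : Window p j (demazure u₂) (p (suc j)) (p (suc (suc j))) (p j)
    S₂ = window-exchange₁ ex₂ refl S₁

  exchange-down-descent : ∀ {j} → j < B → suc j < B → p (suc (suc j)) < p (suc j) → p (suc j) < p j
    → Exchange B (u ++ [ suc j ]) j p (suc (length u))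
  exchange-down-descent {j} jb sjb str d = exchanged (u₃ ++ j ∷ suc j ∷ [])
    (≡H-snoc-++ j [ suc j ] (prefix-≡H ex₁) ⟫ ≡H-snoc-++ (suc j) (j ∷ suc j ∷ []) (prefix-≡H ex₂)
      ⟫ ≡H-snoc-++ j (suc j ∷ j ∷ suc j ∷ []) (prefix-≡H ex₃)
      ⟫ ≡H-congˡ u₃ (≡H-∷ j (≡H-rule (braid (suc j) j))) ⟫ ≡H-congˡ u₃ (≡H-rule-++ (suc j ∷ j ∷ []) (idem j))
      ⟫ ≡H-reflexive (sym (++-assoc u₃ (j ∷ suc j ∷ []) [ j ])))
    (λ m → trans (cong-app (demazure-snoc₂ u₃ j (suc j)) m)
      (window-unique (window-π₁ (window-π₀ S₃ str) (<-trans str d)) (window-swap₀ window-init) m))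
    (subst (_< suc (length u)) (sym (length-snoc₂ u₃ j (suc j)))
      (s≤s (≤-trans (s≤s (<-trans (prefix-shorter ex₃) (prefix-shorter ex₂))) (prefix-shorter ex₁))))
    (++⁺ (prefix-bounded ex₃) (jb ∷ sjb ∷ []))
    where
    ex₁ : ExchangeOf B u j
    ex₁ = IH u j lu bu jb d
    S₁ : Window p j (demazure (prefix ex₁)) (p (suc j)) (p j) (p (suc (suc j)))
    S₁ = window-exchange₀ ex₁ window-init
    ex₂ : ExchangeOf B (prefix ex₁) (suc j)
    ex₂ = IH (prefix ex₁) (suc j) (<-trans (prefix-shorter ex₁) lu) (prefix-bounded ex₁) sjb (window-desc₁ S₁ (<-trans str d))
    S₂ : Window p j (demazure (prefix ex₂)) (p (suc j)) (p (suc (suc j))) (p j)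
    S₂ = window-exchange₁ ex₂ refl S₁
    ex₃ : ExchangeOf B (prefix ex₂) j
    ex₃ = IH (prefix ex₂) j (<-trans (prefix-shorter ex₂) (<-trans (prefix-shorter ex₁) lu)) (prefix-bounded ex₂) jb
      (window-desc₀ S₂ str)
    u₃ = prefix ex₃
    S₃ : Window p j (demazure u₃) (p (suc (suc j))) (p (suc j)) (p j)
    S₃ = window-exchange₀ ex₃ S₂

  exchange-up : ∀ {i} → i < B → suc i < B → π i p (suc (suc i)) < π i p (suc i)
    → Exchange B (u ++ [ i ]) (suc i) (π i p) (suc (length u))
  exchange-up {i} ib sib d with π-cases i p
  ... | inj₁ (lt , e) = subst (λ f → Exchange B (u ++ [ i ]) (suc i) f (suc (length u))) (sym e)
    (exchange-up-ascent ib sib lt (window-desc₁⁻¹ (window-≗ (cong-app (sym e)) (window-swap₀ (window-init {p} {i}))) d))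
  ... | inj₂ (nlt , e) = subst (λ f → Exchange B (u ++ [ i ]) (suc i) f (suc (length u))) (sym e)
    (exchange-up-descent ib sib (nonascent⇒descent i (demazure-injective u) nlt)
      (window-desc₁⁻¹ (window-≗ (cong-app (sym e)) window-init) d))

  exchange-down : ∀ {j} → j < B → suc j < B → π (suc j) p (suc j) < π (suc j) p j
    → Exchange B (u ++ [ suc j ]) j (π (suc j) p) (suc (length u))
  exchange-down {j} jb sjb d with π-cases (suc j) p
  ... | inj₁ (lt , e) = subst (λ f → Exchange B (u ++ [ suc j ]) j f (suc (length u))) (sym e)
    (exchange-down-ascent jb sjb lt (window-desc₀⁻¹ (window-≗ (cong-app (sym e)) (window-swap₁ (window-init {p} {j}))) d))
  ... | inj₂ (nlt , e) = subst (λ f → Exchange B (u ++ [ suc j ]) j f (suc (length u))) (sym e)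
    (exchange-down-descent jb sjb (nonascent⇒descent (suc j) (demazure-injective u) nlt)
      (window-desc₀⁻¹ (window-≗ (cong-app (sym e)) window-init) d))

exchange-snoc : ∀ {n B u i j} → ExchangeBelow n B → length u < n → All (_< B) u → i < B → j < B
  → π i (demazure u) (suc j) < π i (demazure u) j → Exchange B (u ++ [ i ]) j (π i (demazure u)) (suc (length u))
exchange-snoc {i = i} {j} IH lu bu ib jb d with j ≟ i
... | yes refl = exchange-same IH lu bu ib d
... | no j≢i with j ≟ suc i
... | yes refl = exchange-up IH lu bu ib jb d
... | no j≢1+i with i ≟ suc j
... | yes refl = exchange-down IH lu bu jb ib d
... | no i≢1+j = exchange-distant (≢⇒distant i j (≢-sym j≢i) j≢1+i i≢1+j) IH lu bu ib jb d

-- Fuel n bounds the length of w: the recursion descends to prefixes produced by earlier exchanges.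
exchange : ∀ n B w j → length w < n → All (_< B) w → j < B → demazure w (suc j) < demazure w j
  → ExchangeOf B w j
exchange (suc n) B w j lw bw jb d with initLast w
... | [] = ⊥-elim (1+n≰n (<⇒≤ d))
... | u ∷ʳ′ i = normalise (exchange-snoc (exchange n B) lu (++⁻ˡ u bw) ib jb (subst (λ g → g (suc j) < g j) (demazure-snoc u i) d))
  where
  lu : length u < n
  lu = s≤s⁻¹ (subst (_< suc n) (length-snoc u i) lw)
  ib : i < B
  ib with ++⁻ʳ u bw
  ... | h ∷ [] = h
  normalise : Exchange B (u ++ [ i ]) j (π i (demazure u)) (suc (length u)) → ExchangeOf B (u ++ [ i ]) j
  normalise (exchanged w′ e g l b) = exchanged w′ e (λ m → trans (g m) (sym (cong-app (demazure-snoc u i) (τ j m))))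
    (subst (length w′ <_) (sym (length-snoc u i)) l) b

-- Reduced words and 321-patterns

-- Inversions are counted on the positions up to B, which include every position moved by a letter below B.
record ReducedWord (B : ℕ) (w : Word) : Set where
  constructor reduced
  field
    word : Word
    word-≡H : word ≡H w
    word-length : length word ≡ inversions (demazure w) (suc B)
open ReducedWord

BraidedReducedWord : ℕ → Word → Set
BraidedReducedWord B w = Σ (ReducedWord B w) λ r → HasBraid (word r)

reducedWord-minimal : ∀ {B w} (r : ReducedWord B w) → ∀ u → u ≡H w → length (word r) ≤ length u
reducedWord-minimal {B} {w} r u u≡w = begin
  length (word r)                      ≡⟨ word-length r ⟩
  inversions (demazure w) (suc B)      ≡⟨ inversions-≗ (suc B) (λ m → act-≡H u≡w (λ n → n) m) ⟨
  inversions (demazure u) (suc B)      ≤⟨ inversions-demazure≤length (suc B) u ⟩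
  length u                             ∎
  where open ≤-Reasoning

reduced-snoc : ∀ {B w j} (ex : ExchangeOf B w j) → j < B → demazure w (suc j) < demazure w j
  → ReducedWord B (prefix ex) → ReducedWord B w
reduced-snoc {B} {w} {j} ex jb d (reduced r e l) = reduced (r ++ [ j ]) (≡H-congʳ [ j ] e ⟫ ≡H-sym (prefix-≡H ex)) (begin
  length (r ++ [ j ])                                   ≡⟨ length-snoc r j ⟩
  suc (length r)                                        ≡⟨ cong suc l ⟩
  suc (inversions (demazure (prefix ex)) (suc B))       ≡⟨ cong suc (inversions-≗ (suc B) (prefix-demazure ex)) ⟩
  suc (inversions (swapAt j (demazure w)) (suc B))      ≡⟨ inversions-swapAt-descent j (demazure w) (suc B) d (s≤s jb) ⟩
  inversions (demazure w) (suc B)                       ∎)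
  where open ≡-Reasoning

reducedWord : ∀ n B w → length w < n → All (_< B) w → ReducedWord B w
reducedWord (suc n) B w lw bw with initLast w
... | [] = reduced [] ≡H-refl (sym (inversions-id (suc B)))
... | u ∷ʳ′ i with ++⁻ʳ u bw
... | ib ∷ [] = reduced-snoc ex ib descent
  (reducedWord n B (prefix ex) (≤-trans (prefix-shorter ex) (s≤s⁻¹ lw)) (prefix-bounded ex))
  where
  descent : demazure (u ++ [ i ]) (suc i) < demazure (u ++ [ i ]) i
  descent = subst (λ g → g (suc i) < g i) (sym (demazure-snoc u i)) (π-descent i (demazure-injective u))
  ex : ExchangeOf B (u ++ [ i ]) i
  ex = exchange (suc (length (u ++ [ i ]))) B (u ++ [ i ]) i ≤-refl bw ib descent

++-snoc-inner : ∀ {r : Word} a l b x → r ≡ a ++ l ++ b → r ++ [ x ] ≡ a ++ l ++ b ++ [ x ]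
++-snoc-inner a l b x refl = trans (++-assoc a (l ++ b) [ x ]) (cong (a ++_) (++-assoc l b [ x ]))

HasBraid-snoc : ∀ {r} x → HasBraid r → HasBraid (r ++ [ x ])
HasBraid-snoc x (a , b , i , inj₁ e) = a , b ++ [ x ] , i , inj₁ (++-snoc-inner a (i ∷ suc i ∷ i ∷ []) b x e)
HasBraid-snoc x (a , b , i , inj₂ e) = a , b ++ [ x ] , i , inj₂ (++-snoc-inner a (suc i ∷ i ∷ suc i ∷ []) b x e)

braided-snoc : ∀ {B w j} (ex : ExchangeOf B w j) → j < B → demazure w (suc j) < demazure w j
  → BraidedReducedWord B (prefix ex) → BraidedReducedWord B w
braided-snoc {j = j} ex jb d (r , hb) = reduced-snoc ex jb d r , HasBraid-snoc j hb

braided-consecutive : ∀ {B w a} → suc (suc a) ≤ B → All (_< B) w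
  → demazure w (suc a) < demazure w a → demazure w (suc (suc a)) < demazure w (suc a) → BraidedReducedWord B w
braided-consecutive {B} {w} {a} cB bw d₁ d₂ =
  reduced-snoc ex₁ aB d₁ (reduced-snoc ex₂ saB dd₁ (reduced-snoc ex₃ aB dd₂ r)) , word r , [] , a , inj₁ braid-at-end
  where
  p = demazure w
  aB : a < B
  aB = <-trans ≤-refl cB
  saB : suc a < B
  saB = cB
  ex₁ : ExchangeOf B w a
  ex₁ = exchange (suc (length w)) B w a ≤-refl bw aB d₁
  S₁ : Window p a (demazure (prefix ex₁)) (p (suc a)) (p a) (p (suc (suc a)))
  S₁ = window-exchange₀ ex₁ window-init
  dd₁ : demazure (prefix ex₁) (suc (suc a)) < demazure (prefix ex₁) (suc a)
  dd₁ = window-desc₁ S₁ (<-trans d₂ d₁)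
  ex₂ : ExchangeOf B (prefix ex₁) (suc a)
  ex₂ = exchange (suc (length (prefix ex₁))) B (prefix ex₁) (suc a) ≤-refl (prefix-bounded ex₁) saB dd₁
  S₂ : Window p a (demazure (prefix ex₂)) (p (suc a)) (p (suc (suc a))) (p a)
  S₂ = window-exchange₁ ex₂ refl S₁
  dd₂ : demazure (prefix ex₂) (suc a) < demazure (prefix ex₂) a
  dd₂ = window-desc₀ S₂ d₂
  ex₃ : ExchangeOf B (prefix ex₂) a
  ex₃ = exchange (suc (length (prefix ex₂))) B (prefix ex₂) a ≤-refl (prefix-bounded ex₂) aB dd₂
  r : ReducedWord B (prefix ex₃)
  r = reducedWord (suc (length (prefix ex₃))) B (prefix ex₃) ≤-refl (prefix-bounded ex₃)
  braid-at-end : ((word r ++ [ a ]) ++ [ suc a ]) ++ [ a ] ≡ word r ++ (a ∷ suc a ∷ a ∷ []) ++ []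
  braid-at-end = trans (++-assoc (word r ++ [ a ]) [ suc a ] [ a ]) (++-assoc (word r) [ a ] (suc a ∷ a ∷ []))

Pattern321 : (ℕ → ℕ) → Set
Pattern321 f = Σ ℕ λ a → Σ ℕ λ b → Σ ℕ λ c → a < b × b < c × f b < f a × f c < f b

-- g bounds c - a: the outer entries of the pattern are moved inwards, by exchanges when needed,
-- until a, b, c are consecutive.
pattern321⇒braided : ∀ g B w a b c → c ≤ g + a → a < b → b < c → c ≤ B → All (_< B) w
  → demazure w b < demazure w a → demazure w c < demazure w b → BraidedReducedWord B w
pattern321⇒braided zero B w a b c cg ab bc cB bw d₁ d₂ = ⊥-elim (<-irrefl refl (≤-trans (<-trans ab bc) cg))
pattern321⇒braided (suc g) B w a b c cg ab bc cB bw d₁ d₂ with suc a ≟ b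
... | no a+1≢b = shift (<-cmp (p a) (p (suc a)))
  where
  p = demazure w
  ab′ : suc a < b
  ab′ = ≤∧≢⇒< ab a+1≢b
  cg′ : c ≤ g + suc a
  cg′ = subst (c ≤_) (sym (+-suc g a)) cg
  aB : a < B
  aB = <-≤-trans (<-trans ab bc) cB
  shift : Tri (p a < p (suc a)) (p a ≡ p (suc a)) (p (suc a) < p a) → BraidedReducedWord B w
  shift (tri< lt _ _) = pattern321⇒braided g B w (suc a) b c cg′ ab′ bc cB bw (<-trans d₁ lt) d₂
  shift (tri≈ _ eq _) = ⊥-elim (1+n≢n (sym (demazure-injective w eq)))
  shift (tri> _ _ gt) = braided-snoc ex aB gt
    (pattern321⇒braided g B (prefix ex) (suc a) b c cg′ ab′ bc cB (prefix-bounded ex)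
      (subst₂ _<_ (sym (fixed ab′)) (sym moved) d₁) (subst₂ _<_ (sym (fixed (<-trans ab′ bc))) (sym (fixed ab′)) d₂))
    where
    ex : ExchangeOf B w a
    ex = exchange (suc (length w)) B w a ≤-refl bw aB gt
    moved : demazure (prefix ex) (suc a) ≡ p a
    moved = trans (prefix-demazure ex (suc a)) (swapAt-1+i a p)
    fixed : ∀ {n} → suc a < n → demazure (prefix ex) n ≡ p n
    fixed h = trans (prefix-demazure ex _) (cong p (τ-above h))
pattern321⇒braided (suc g) B w a .(suc a) c cg ab bc cB bw d₁ d₂ | yes refl with suc (suc a) ≟ c
... | yes refl = braided-consecutive cB bw d₁ d₂
pattern321⇒braided (suc g) B w a .(suc a) (suc c) cg ab bc cB bw d₁ d₂ | yes refl | no a+2≢c+1 =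
  shift (<-cmp (p c) (p (suc c)))
  where
  p = demazure w
  bc′ : suc a < c
  bc′ = s≤s⁻¹ (≤∧≢⇒< bc a+2≢c+1)
  shift : Tri (p c < p (suc c)) (p c ≡ p (suc c)) (p (suc c) < p c) → BraidedReducedWord B w
  shift (tri< lt _ _) = pattern321⇒braided g B w a (suc a) c (s≤s⁻¹ cg) ab bc′ (<⇒≤ cB) bw d₁ (<-trans lt d₂)
  shift (tri≈ _ eq _) = ⊥-elim (1+n≢n (sym (demazure-injective w eq)))
  shift (tri> _ _ gt) = braided-snoc ex cB gt
    (pattern321⇒braided g B (prefix ex) a (suc a) c (s≤s⁻¹ cg) ab bc′ (<⇒≤ cB) (prefix-bounded ex)
      (subst₂ _<_ (sym (fixed bc′)) (sym (fixed (<-trans ab bc′))) d₁) (subst₂ _<_ (sym moved) (sym (fixed bc′)) d₂))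
    where
    ex : ExchangeOf B w c
    ex = exchange (suc (length w)) B w c ≤-refl bw cB gt
    moved : demazure (prefix ex) c ≡ p (suc c)
    moved = trans (prefix-demazure ex c) (swapAt-i c p)
    fixed : ∀ {n} → n < c → demazure (prefix ex) n ≡ p n
    fixed h = trans (prefix-demazure ex _) (cong p (τ-below h))

fullyCommutative⇒no321 : ∀ w → FullyCommutative w → ¬ Pattern321 (demazure w)
fullyCommutative⇒no321 w fc (a , b , c , ab , bc , d₁ , d₂)
  with pattern321⇒braided c B w a b c (m≤m+n c a) ab bc (m≤n+m c (suc (sum w))) bw d₁ d₂
  where
  B : ℕ
  B = suc (sum w) + c
  bw : All (_< B) w
  bw = all-map (λ h → ≤-trans (s≤s h) (m≤m+n _ c)) (≤-sum w)
... | r , hb = fc (word r) (word-≡H r , reducedWord-minimal r) hb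

Pattern321-≗ : ∀ {f g} → f ≗ g → Pattern321 f → Pattern321 g
Pattern321-≗ e (a , b , c , ab , bc , d₁ , d₂) = a , b , c , ab , bc , subst₂ _<_ (e b) (e a) d₁ , subst₂ _<_ (e c) (e b) d₂

-- A sorting step only moves a larger entry leftwards past a smaller one, so decreasing subsequences survive.
Pattern321-π : ∀ i {f} → Pattern321 f → Pattern321 (π i f)
Pattern321-π i {f} pt@(a , b , c , ab , bc , d₁ , d₂) with π-cases i f
... | inj₂ (_ , e) rewrite e = pt
... | inj₁ (lt , e) rewrite e =
  τ i a , τ i b , τ i c ,
  τ-mono i ab (λ ea eb → <-asym lt (subst₂ _<_ (cong f eb) (cong f ea) d₁)) ,
  τ-mono i bc (λ ea eb → <-asym lt (subst₂ _<_ (cong f eb) (cong f ea) d₂)) ,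
  subst₂ _<_ (sym (cong f (τ-involutive i b))) (sym (cong f (τ-involutive i a))) d₁ ,
  subst₂ _<_ (sym (cong f (τ-involutive i c))) (sym (cong f (τ-involutive i b))) d₂

Pattern321-act : ∀ u {f} → Pattern321 f → Pattern321 (act u f)
Pattern321-act [] pt = pt
Pattern321-act (i ∷ u) pt = Pattern321-act u (Pattern321-π i pt)

Pattern321-braid : ∀ x {f} → Injective _≡_ _≡_ f → Pattern321 (π x (π (suc x) (π x f)))
Pattern321-braid x {f} inj =
  x , suc x , suc (suc x) , ≤-refl , ≤-refl , π-descent x (π-injective (suc x) (π-injective x inj)) ,
  subst₂ _<_ (sym (π-other x h₂ 2+n≢n 1+n≢n)) (sym (π-1+i x h₂)) (⊓-glb below-x (π-descent (suc x) (π-injective x inj)))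
  where
  h₁ = π x f
  h₂ = π (suc x) h₁
  below-x : h₂ (suc (suc x)) < h₂ x
  below-x = begin-strict
    h₂ (suc (suc x))                 ≡⟨ π-1+i (suc x) h₁ ⟩
    h₁ (suc x) ⊓ h₁ (suc (suc x))    ≤⟨ m⊓n≤m _ _ ⟩
    h₁ (suc x)                       <⟨ π-descent x inj ⟩
    h₁ x                             ≡⟨ π-other (suc x) h₁ n≢1+n n≢2+n ⟨
    h₂ x                             ∎
    where open ≤-Reasoning

-- Row insertion

sorted-head : ∀ {r R} → Linked _<_ (r ∷ R) → All (r <_) R
sorted-head [-] = []
sorted-head (h ∷ l) = Linked⇒All <-trans h l

all-distant : ∀ {x R} → All (x <_) R → suc x ∉ R → All (Distant x) R
all-distant [] _ = []
all-distant (h ∷ hs) n = <⇒distant (≤∧≢⇒< h (λ e → n (here e))) ∷ all-distant hs (λ k → n (there k))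

row-absorbs-last : ∀ x R → Linked _<_ R → x ∈ R → suc x ∉ R → (R ++ [ x ]) ≡H R
row-absorbs-last x (.x ∷ R) s (here refl) n =
  ≡H-∷ x (commute-past x R (all-distant (sorted-head s) (λ k → n (there k)))) ⟫ ≡H-rule-++ R (idem x)
row-absorbs-last x (r ∷ R) s (there h) n = ≡H-∷ r (row-absorbs-last x R (Linked.tail s) h (λ k → n (there k)))

row-absorbs-first : ∀ y R → Linked _<_ R → y ∈ R → (∀ m → y ≡ suc m → m ∉ R) → (y ∷ R) ≡H R
row-absorbs-first y (.y ∷ R) s (here refl) c = ≡H-rule-++ R (idem y)
row-absorbs-first y (r ∷ R) s (there h) c with y
... | zero = ⊥-elim (1+n≰n (≤-trans (all-lookup (sorted-head s) h) z≤n))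
... | suc m = commute (suc m) r R (distant-sym (<⇒distant (s≤s r<m)))
      ⟫ ≡H-∷ r (row-absorbs-first (suc m) R (Linked.tail s) h (λ k e k∈R → c k e (there k∈R)))
  where
  r<m : r < m
  r<m = ≤∧≢⇒< (s≤s⁻¹ (all-lookup (sorted-head s) h)) (λ e → c m refl (here (sym e)))

downFrom∈ : ∀ x R → x ∈ R → downFrom x R ∈ R
downFrom∈ zero R h = h
downFrom∈ (suc n) R h with n ∈? R
... | yes n∈R = downFrom∈ n R n∈R
... | no _ = h

downFrom-pred∉ : ∀ x R → x ∈ R → ∀ m → downFrom x R ≡ suc m → m ∉ R
downFrom-pred∉ zero R h m ()
downFrom-pred∉ (suc n) R h m e with n ∈? R
... | yes n∈R = downFrom-pred∉ n R n∈R m e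
... | no n∉R = subst (_∉ R) (suc-injective e) n∉R

-- Both sides reduce to R: the letter x merges into its copy in R by commuting past the larger
-- letters, which are all distant from x because suc x ∉ R.
insert-case3 : ∀ x R → Linked _<_ R → x ∈ R → suc x ∉ R → (downFrom x R ∷ R) ≡H (R ++ [ x ])
insert-case3 x R s h n =
  row-absorbs-first (downFrom x R) R s (downFrom∈ x R h) (downFrom-pred∉ x R h) ⟫ ≡H-sym (row-absorbs-last x R s h n)

row-split-consecutive : ∀ x R → Linked _<_ R → x ∈ R → suc x ∈ R
  → Σ (List ℕ) λ S → Σ (List ℕ) λ B → (R ≡ S ++ x ∷ suc x ∷ B) × All (Distant x) B
row-split-consecutive x (.x ∷ []) s (here refl) (here e) = ⊥-elim (1+n≢n e)
row-split-consecutive x (.x ∷ []) s (here refl) (there ())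
row-split-consecutive x (.x ∷ r ∷ R) (lt ∷ s) (here refl) (here e) = ⊥-elim (1+n≢n e)
row-split-consecutive x (.x ∷ r ∷ R) (lt ∷ s) (here refl) (there (here e)) =
  [] , R , cong (λ z → x ∷ z ∷ R) (sym e) , all-map (λ {b} h → <⇒distant (subst (_< b) (sym e) h)) (sorted-head s)
row-split-consecutive x (.x ∷ r ∷ R) (lt ∷ s) (here refl) (there (there k)) =
  ⊥-elim (<-irrefl refl (<-≤-trans (all-lookup (sorted-head s) k) lt))
row-split-consecutive x (r ∷ R) s (there h) h′ with row-split-consecutive x R (Linked.tail s) h (tail h′)
  where
  tail : suc x ∈ (r ∷ R) → suc x ∈ R
  tail (there k) = k
  tail (here refl) = ⊥-elim (<-asym (all-lookup (sorted-head s) h) ≤-refl)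
... | S , B , e , fa = r ∷ S , B , cong (r ∷_) e , fa

insert-case3-321 : ∀ x R → Linked _<_ R → x ∈ R → suc x ∈ R → ∀ U → Pattern321 (demazure (U ++ R ++ [ x ]))
insert-case3-321 x R s h h′ U with row-split-consecutive x R s h h′
... | S , B , refl , fa = Pattern321-≗ (act-≡H braided (λ n → n))
  (subst Pattern321 (sym (act-++ (U ++ S) ((x ∷ suc x ∷ x ∷ []) ++ B) (λ n → n)))
    (Pattern321-act B (Pattern321-braid x (demazure-injective (U ++ S)))))
  where
  braided : ((U ++ S) ++ (x ∷ suc x ∷ x ∷ []) ++ B) ≡H (U ++ (S ++ x ∷ suc x ∷ B) ++ [ x ])
  braided = ≡H-congˡ (U ++ S) (≡H-∷ x (≡H-∷ (suc x) (≡H-sym (commute-past x B fa))))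
    ⟫ ≡H-reflexive (trans (++-assoc U S _) (cong (U ++_) (sym (++-assoc S (x ∷ suc x ∷ B) [ x ]))))

smallestAbove-just : ∀ x R {z} → smallestAbove x R ≡ just z → z ∈ R × x < z
smallestAbove-just x (r ∷ R) eq with smallestAbove x R in em | x <? r
... | m | no _ = let (z∈R , x<z) = smallestAbove-just x R (trans em eq) in there z∈R , x<z
... | nothing | yes lt with eq
... | refl = here refl , lt
smallestAbove-just x (r ∷ R) eq | just z′ | yes lt with r <? z′
... | yes _ with eq
... | refl = here refl , lt
smallestAbove-just x (r ∷ R) refl | just z′ | yes lt | no _ =
  let (z∈R , x<z) = smallestAbove-just x R em in there z∈R , x<z

smallestAbove-head : ∀ x r R → x < r → (∀ z → smallestAbove x R ≡ just z → r < z) → smallestAbove x (r ∷ R) ≡ just r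
smallestAbove-head x r R lt h with smallestAbove x R in em | x <? r
... | _ | no n = ⊥-elim (n lt)
... | nothing | yes _ = refl
... | just z | yes _ with r <? z
... | yes _ = refl
... | no n = ⊥-elim (n (h z refl))

smallestAbove-tail : ∀ x r R → ¬ (x < r) → smallestAbove x (r ∷ R) ≡ smallestAbove x R
smallestAbove-tail x r R n with smallestAbove x R | x <? r
... | m | no _ = refl
... | m | yes p = ⊥-elim (n p)

replace-∉ : ∀ y x R → y ∉ R → replace y x R ≡ R
replace-∉ y x [] _ = refl
replace-∉ y x (r ∷ R) n with r ≟ y
... | yes e = ⊥-elim (n (here (sym e)))
... | no _ = cong (r ∷_) (replace-∉ y x R (λ k → n (there k)))

replace-here : ∀ y x R → replace y x (y ∷ R) ≡ x ∷ replace y x R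
replace-here y x R with y ≟ y
... | yes _ = refl
... | no n = ⊥-elim (n refl)

replace-there : ∀ y x r R → r ≢ y → replace y x (r ∷ R) ≡ r ∷ replace y x R
replace-there y x r R ne with r ≟ y
... | yes e = ⊥-elim (ne e)
... | no _ = refl

-- x commutes leftwards past the letters above y, which exceed x + 1, until it sits where y was.
insert-case2 : ∀ x R → Linked _<_ R → x ∉ R → ∀ {y} → smallestAbove x R ≡ just y → (y ∷ replace y x R) ≡H (R ++ [ x ])
insert-case2 x (r ∷ R) s n {y} eq with <-cmp x r
... | tri≈ _ e _ = ⊥-elim (n (here e))
... | tri< lt _ _
  with trans (sym eq) (smallestAbove-head x r R lt (λ z ez → all-lookup (sorted-head s) (proj₁ (smallestAbove-just x R ez))))
... | refl = ≡H-reflexive (cong (r ∷_) (trans (replace-here r x R) (cong (x ∷_) (replace-∉ r x R r∉R))))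
      ⟫ ≡H-∷ r (≡H-sym (commute-past x R (all-map (λ h → <⇒distant (≤-<-trans lt h)) (sorted-head s))))
  where
  r∉R : r ∉ R
  r∉R k = <-irrefl refl (all-lookup (sorted-head s) k)
insert-case2 x (r ∷ R) s n {y} eq | tri> _ _ gt =
  ≡H-reflexive (cong (y ∷_) (replace-there y x r R (λ e → <-asym gt (subst (x <_) (sym e) x<y))))
  ⟫ commute y r _ (distant-sym (<⇒distant (≤-<-trans gt x<y)))
  ⟫ ≡H-∷ r (insert-case2 x R (Linked.tail s) (λ k → n (there k)) eq′)
  where
  eq′ : smallestAbove x R ≡ just y
  eq′ = trans (sym (smallestAbove-tail x r R (λ k → <-asym k gt))) eq
  x<y : x < y
  x<y = proj₂ (smallestAbove-just x R eq′)

RowInsertCorrect : ℕ → List ℕ → List ℕ × Maybe ℕ → Set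
RowInsertCorrect x R (R′ , nothing) = R′ ≡H (R ++ [ x ])
RowInsertCorrect x R (R′ , just y) = (y ∷ R′) ≡H (R ++ [ x ])

rowInsert-correct : ∀ x R → Linked _<_ R → (∀ U → Pattern321 (demazure (U ++ R ++ [ x ]))) ⊎ RowInsertCorrect x R (rowInsert x R)
rowInsert-correct x R s with x ∈? R
... | yes x∈R with suc x ∈? R
...   | yes x+1∈R = inj₁ (insert-case3-321 x R s x∈R x+1∈R)
...   | no x+1∉R = inj₂ (insert-case3 x R s x∈R x+1∉R)
rowInsert-correct x R s | no x∉R with smallestAbove x R in eq
... | nothing = inj₂ ≡H-refl
... | just y = inj₂ (insert-case2 x R s x∉R eq)

row-∷ : ∀ R P → row (R ∷ P) ≡ row P ++ R
row-∷ R P = trans (cong concat (unfold-reverse R P)) (trans (sym (concat-++ (reverse P) [ R ])) (cong (row P ++_) (++-identityʳ R)))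

row-∷-snoc : ∀ R P x → row (R ∷ P) ++ [ x ] ≡ row P ++ R ++ [ x ]
row-∷-snoc R P x = trans (cong (_++ [ x ]) (row-∷ R P)) (++-assoc (row P) R [ x ])

Pattern321-++ : ∀ u v → Pattern321 (demazure u) → Pattern321 (demazure (u ++ v))
Pattern321-++ u v pt = subst Pattern321 (sym (act-++ u v (λ n → n))) (Pattern321-act v pt)

insert-≡H-or-321 : ∀ P x → All (Linked _<_) P → (row (P ← x) ≡H (row P ++ [ x ])) ⊎ Pattern321 (demazure (row P ++ [ x ]))
insert-≡H-or-321 [] x _ = inj₁ ≡H-refl
insert-≡H-or-321 (R ∷ P) x (sR ∷ sP) with rowInsert x R | rowInsert-correct x R sR
... | _ | inj₁ pt = inj₂ (subst (Pattern321 ∘ demazure) (sym (row-∷-snoc R P x)) (pt (row P)))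
... | R′ , nothing | inj₂ e =
  inj₁ (≡H-reflexive (row-∷ R′ P) ⟫ ≡H-congˡ (row P) e ⟫ ≡H-reflexive (sym (row-∷-snoc R P x)))
... | R′ , just y | inj₂ e =
  Sum.map (λ e′ → ≡H-reflexive (row-∷ R′ (P ← y)) ⟫ ≡H-congʳ R′ e′ ⟫ bumped)
          (λ pt → Pattern321-≗ (act-≡H bumped (λ n → n)) (Pattern321-++ (row P ++ [ y ]) R′ pt))
          (insert-≡H-or-321 P y sP)
  where
  bumped : ((row P ++ [ y ]) ++ R′) ≡H (row (R ∷ P) ++ [ x ])
  bumped = ≡H-reflexive (++-assoc (row P) [ y ] R′) ⟫ ≡H-congˡ (row P) e ⟫ ≡H-reflexive (sym (row-∷-snoc R P x))

lemma3p11 : (P : Tableau) (x : ℕ) → TransposeSemistandard P → FullyCommutative (row P)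
    → 1 ≤ x → FullyCommutative (row P ++ [ x ])
    → row (P ← x) ≡H (row P ++ [ x ])
lemma3p11 P x (_ , _ , rows-increasing , _) _ _ fc with insert-≡H-or-321 P x rows-increasing
... | inj₁ e = e
... | inj₂ pt = ⊥-elim (fullyCommutative⇒no321 (row P ++ [ x ]) fc pt)
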